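{- Let $\Pi_{\rm odd}$ be the map on $\mathbb{N}=\{1,2,3,\dots\}$ produced by the following procedure. At step $1$ set $\Pi_{\rm odd}(1)=1$. For $m=2,3,4,\dots$ in turn, at step $m$: if $m$ is odd or $\Pi_{\rm odd}(m-\lfloor m/2\rfloor)$ has been assigned at an earlier step, set $\Pi_{\rm odd}(m+\lfloor m/2\rfloor)=m$; otherwise set $\Pi_{\rm odd}(m-\lfloor m/2\rfloor)=m$. Let $\sigma$ be the morphism on $\{2,3,4\}^*$ given by $\sigma(2)=322$, $\sigma(3)=324$, $\sigma(4)=324$, and let $s_{\rm odd}=s_{\rm odd}(1)s_{\rm odd}(2)\dots=324322324\dots$ be its unique fixed point (it starts with $3$). Then for every $n\ge1$: $s_{\rm odd}(n)=2$ iff $\Pi_{\rm odd}(n)$ has type (II); $s_{\rm odd}(n)=3$ iff $\Pi_{\rm odd}(n)$ has type (III); $s_{\rm odd}(n)=4$ iff $\Pi_{\rm odd}(n)$ has type (IV).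
   Context: The procedure assigns a value $\Pi_{\rm odd}(n)$ to every $n\in\mathbb{N}$. Types: for $n\ge2$, $\Pi_{\rm odd}(n)$ has type (I) if $\Pi_{\rm odd}(n)>n$ and $\Pi_{\rm odd}(n)=2n-1$; type (II) if $\Pi_{\rm odd}(n)>n$ and $\Pi_{\rm odd}(n)=2n$; type (III) if $\Pi_{\rm odd}(n)<n$ and $\Pi_{\rm odd}(n)=(2n+1)/3$; type (IV) if $\Pi_{\rm odd}(n)<n$ and $\Pi_{\rm odd}(n)=2n/3$. By definition, $\Pi_{\rm odd}(1)=1$ has type (III) (and no other type). -}

module Defs where

open import Data.Nat using (ℕ; zero; suc; _+_; _*_; _∸_; _≤_; _<_; _≟_)
open import Data.Nat.DivMod using (_/_; _%_)
open import Data.List using (List; []; _∷_)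
open import Data.List.Membership.DecPropositional _≟_ using (_∈?_)
open import Data.Product using (_×_)
open import Data.Sum using (_⊎_)
open import Relation.Nullary using (yes; no)
open import Relation.Binary.PropositionalEquality using (_≡_)

-- Position chosen at step m (m ≥ 2), given the list `ts` of positions
-- assigned at steps 1 .. m-1.
nextPos : ℕ → List ℕ → ℕ
nextPos m ts with m % 2 ≟ 1
... | yes _ = m + m / 2
... | no _ with (m ∸ m / 2) ∈? ts
...   | yes _ = m + m / 2
...   | no _  = m ∸ m / 2

assignedUpTo : ℕ → List ℕ
target : ℕ → ℕ

assignedUpTo zero = []
assignedUpTo (suc m) = target (suc m) ∷ assignedUpTo m

target zero = zero                 -- unused (no step 0)
target (suc zero) = suc zero
target (suc (suc k)) = nextPos (suc (suc k)) (assignedUpTo (suc k))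

-- IsPi n m  :⇔  Π_odd(n) = m, i.e. position n is assigned at step m
IsPi : ℕ → ℕ → Set
IsPi n m = 1 ≤ m × target m ≡ n

TypeI : ℕ → ℕ → Set
TypeI n m = 2 ≤ n × n < m × m + 1 ≡ 2 * n

TypeII : ℕ → ℕ → Set
TypeII n m = 2 ≤ n × n < m × m ≡ 2 * n

TypeIII : ℕ → ℕ → Set
TypeIII n m = (n ≡ 1) ⊎ (2 ≤ n × m < n × 3 * m ≡ 2 * n + 1)

TypeIV : ℕ → ℕ → Set
TypeIV n m = 2 ≤ n × m < n × 3 * m ≡ 2 * n

data Letter : Set where
  two three four : Letter

-- σ(a) is a word of length 3, given as its three letters
σ₁ σ₂ σ₃ : Letter → Letter
σ₁ _ = three
σ₂ _ = two
σ₃ two = two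
σ₃ three = four
σ₃ four = four

-- s : ℕ → Letter, positions 1,2,3,… (value at 0 irrelevant), is a fixed
-- point of σ starting with 3:  s(3k+1) s(3k+2) s(3k+3) = σ(s(k+1)).
IsFixedPoint : (ℕ → Letter) → Set
IsFixedPoint s =
  s 1 ≡ three ×
  (∀ k → s (3 * k + 1) ≡ σ₁ (s (suc k))
       × s (3 * k + 2) ≡ σ₂ (s (suc k))
       × s (3 * k + 3) ≡ σ₃ (s (suc k)))

module Submission where

open import Defs
open import Data.Nat using (ℕ; _≤_)
open import Data.Product using (_×_; ∃)
open import Function.Bundles using (_⇔_)
open import Relation.Binary.PropositionalEquality using (_≡_)

open import Data.Nat using (zero; suc; _+_; _*_; _∸_; _<_; _≟_; z≤n; s≤s; s<s⁻¹)
open import Data.Nat.Properties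
open import Data.Nat.DivMod using (_/_; _%_; [m+kn]%n≡m%n; m*n%n≡0; m*n/n≡m; +-distrib-/)
open import Data.Nat.Induction using (<-rec)
open import Data.Nat.Tactic.RingSolver using (solve-∀)
open import Data.List.Membership.DecPropositional _≟_ using (_∈_; _∈?_)
open import Data.List.Relation.Unary.Any using (here; there)
open import Data.Product using (_,_; proj₁; proj₂)
open import Algebra.Definitions.RawMagma using (_,_)
open import Data.Sum using (inj₁; inj₂)
open import Data.Empty using (⊥-elim)
open import Relation.Nullary using (¬_; Dec; yes; no; contradiction)
open import Relation.Binary.PropositionalEquality
  using (refl; sym; trans; cong; subst; _≢_; module ≡-Reasoning)
open import Function.Bundles using (mk⇔)

-- Write Π(n) = m when position n is filled at step m.  For a letter l let
-- `Ratio l n m` be the linear relation the type named by l imposes on n and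
-- m: m = 2n for 2, 3m = 2n + 1 for 3, 3m = 2n for 4.  The heart of the proof
-- is that every step m satisfies Ratio (s (target m)) (target m) m: the
-- letter of s at the position filled at step m records how m was chosen.
-- Odd steps 1 + 2k always fill 1 + 3k, where s reads 3.  An even step 2j
-- fills j if s(j) = 2 and 3j otherwise (`target-even`); this is proved by
-- strong induction on j, because by the ratio property of the earlier steps
-- position j is still free at step 2j exactly when s(j) = 2.
-- Since a ratio determines m from n, Π is well defined; a case split on n
-- mod 3 shows every position is filled.  Finally the ratio prescribed by
-- s(n) yields the type of Π(n), and the types are mutually exclusive, which
-- gives the three equivalences of the theorem.

Ratio : Letter → ℕ → ℕ → Set
Ratio two   n m = m ≡ 2 * n
Ratio three n m = 3 * m ≡ 2 * n + 1
Ratio four  n m = 3 * m ≡ 2 * n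

ratio-injective : ∀ l {n a b} → Ratio l n a → Ratio l n b → a ≡ b
ratio-injective two   ea eb = trans ea (sym eb)
ratio-injective three ea eb = *-cancelˡ-≡ _ _ 3 (trans ea (sym eb))
ratio-injective four  ea eb = *-cancelˡ-≡ _ _ 3 (trans ea (sym eb))

TypeOf : Letter → ℕ → ℕ → Set
TypeOf two   = TypeII
TypeOf three = TypeIII
TypeOf four  = TypeIV

below-by-thirds : ∀ {m n c} → c < n → 3 * m ≡ 2 * n + c → m < n
below-by-thirds {m} {n} {c} c<n e = *-cancelˡ-< 3 m n (begin-strict
  3 * m      ≡⟨ e ⟩
  2 * n + c  <⟨ +-monoʳ-< (2 * n) c<n ⟩
  2 * n + n  ≡⟨ +-comm (2 * n) n ⟩
  3 * n      ∎)
  where open ≤-Reasoning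

-- The ratio named by a letter yields the type named by it, provided n ≥ 2
-- unless the letter is 3 (position 1 carries the letter 3).
ratio⇒type : ∀ l {n m} → 1 ≤ n → (l ≢ three → 2 ≤ n) → Ratio l n m → TypeOf l n m
ratio⇒type two {n} n≥1 n≥2 e = n≥2 (λ ()) , subst (n <_) (sym e) n<2n , e
  where
  n<2n : n < 2 * n
  n<2n = subst (n <_) (cong (n +_) (sym (+-identityʳ n))) (m<m+n n n≥1)
ratio⇒type three {suc zero}    _ _ _ = inj₁ refl
ratio⇒type three {suc (suc _)} _ _ e =
  inj₂ (s≤s (s≤s z≤n) , below-by-thirds (s≤s (s≤s z≤n)) e , e)
ratio⇒type four n≥1 n≥2 e =
  n≥2 (λ ()) , below-by-thirds n≥1 (trans e (sym (+-identityʳ _))) , e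

II∧III⇒⊥ : ∀ {n m} → TypeII n m → ¬ TypeIII n m
II∧III⇒⊥ (s≤s () , _ , _) (inj₁ refl)
II∧III⇒⊥ (_ , n<m , _) (inj₂ (_ , m<n , _)) = <-asym n<m m<n

II∧IV⇒⊥ : ∀ {n m} → TypeII n m → ¬ TypeIV n m
II∧IV⇒⊥ (_ , n<m , _) (_ , m<n , _) = <-asym n<m m<n

III∧IV⇒⊥ : ∀ {n m} → TypeIII n m → ¬ TypeIV n m
III∧IV⇒⊥ (inj₁ refl) (s≤s () , _ , _)
III∧IV⇒⊥ {n} (inj₂ (_ , _ , e)) (_ , _ , e′) =
  1+n≢n (trans (+-comm 1 (2 * n)) (trans (sym e) e′))

type-determines-letter : ∀ l l′ {n m} → TypeOf l n m → TypeOf l′ n m → l ≡ l′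
type-determines-letter two   two   _ _  = refl
type-determines-letter two   three t t′ = ⊥-elim (II∧III⇒⊥ t t′)
type-determines-letter two   four  t t′ = ⊥-elim (II∧IV⇒⊥ t t′)
type-determines-letter three two   t t′ = ⊥-elim (II∧III⇒⊥ t′ t)
type-determines-letter three three _ _  = refl
type-determines-letter three four  t t′ = ⊥-elim (III∧IV⇒⊥ t t′)
type-determines-letter four  two   t t′ = ⊥-elim (II∧IV⇒⊥ t′ t)
type-determines-letter four  three t t′ = ⊥-elim (III∧IV⇒⊥ t′ t)
type-determines-letter four  four  _ _  = refl

letter⇔type : ∀ l {n m} → TypeOf l n m → ∀ l′ → (l ≡ l′ ⇔ TypeOf l′ n m)
letter⇔type l t l′ = mk⇔ (λ { refl → t }) (type-determines-letter l l′ t)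

nextPos-odd : ∀ m ts → m % 2 ≡ 1 → nextPos m ts ≡ m + m / 2
nextPos-odd m ts odd with m % 2 ≟ 1
... | yes _   = refl
... | no even = contradiction odd even

nextPos-taken : ∀ m ts → m % 2 ≢ 1 → (m ∸ m / 2) ∈ ts → nextPos m ts ≡ m + m / 2
nextPos-taken m ts even taken with m % 2 ≟ 1
... | yes odd = contradiction odd even
... | no _ with (m ∸ m / 2) ∈? ts
...   | yes _    = refl
...   | no free  = contradiction taken free

nextPos-free : ∀ m ts → m % 2 ≢ 1 → ¬ (m ∸ m / 2) ∈ ts → nextPos m ts ≡ m ∸ m / 2
nextPos-free m ts even free with m % 2 ≟ 1
... | yes odd = contradiction odd even
... | no _ with (m ∸ m / 2) ∈? ts
...   | yes taken = contradiction taken free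
...   | no _      = refl

AssignedBefore : ℕ → ℕ → Set
AssignedBefore m x = ∃ λ m′ → 1 ≤ m′ × m′ < m × target m′ ≡ x

∈assignedUpTo⇒ : ∀ k {x} → x ∈ assignedUpTo k → AssignedBefore (suc k) x
∈assignedUpTo⇒ (suc k) (here x≡t) = suc k , s≤s z≤n , n<1+n (suc k) , sym x≡t
∈assignedUpTo⇒ (suc k) (there x∈) =
  let m , m≥1 , m<k+1 , t = ∈assignedUpTo⇒ k x∈ in m , m≥1 , m<n⇒m<1+n m<k+1 , t

⇒∈assignedUpTo : ∀ k {x} → AssignedBefore (suc k) x → x ∈ assignedUpTo k
⇒∈assignedUpTo zero (m , m≥1 , m<1 , _) = contradiction m≥1 (<⇒≱ m<1)
⇒∈assignedUpTo (suc k) (m , m≥1 , m<k+2 , t) with m ≟ suc k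
... | yes refl = here (sym t)
... | no m≢k+1 = there (⇒∈assignedUpTo k (m , m≥1 , ≤∧≢⇒< (≤-pred m<k+2) m≢k+1 , t))

target-odd : ∀ k → target (1 + k * 2) ≡ 1 + k * 3
target-odd zero    = refl
target-odd (suc k) = begin
  target m       ≡⟨ nextPos-odd m (assignedUpTo (suc k * 2)) ([m+kn]%n≡m%n 1 (suc k) 2) ⟩
  m + m / 2      ≡⟨ cong (m +_) half ⟩
  m + suc k      ≡⟨ sum (suc k) ⟩
  1 + suc k * 3  ∎
  where
  open ≡-Reasoning
  m = 1 + suc k * 2
  half : m / 2 ≡ suc k
  half = trans (+-distrib-/ 1 (suc k * 2) (subst (λ r → 1 + r < 2) (sym (m*n%n≡0 (suc k) 2)) ≤-refl))
               (m*n/n≡m (suc k) 2)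
  sum : ∀ j → 1 + j * 2 + j ≡ 1 + j * 3
  sum = solve-∀

even-rem : ∀ j → j * 2 % 2 ≢ 1
even-rem j odd with trans (sym (m*n%n≡0 j 2)) odd
... | ()

even-diff : ∀ j → j * 2 ∸ j * 2 / 2 ≡ j
even-diff j = begin
  j * 2 ∸ j * 2 / 2  ≡⟨ cong (j * 2 ∸_) (m*n/n≡m j 2) ⟩
  j * 2 ∸ j          ≡⟨ cong (_∸ j) (trans (*-comm j 2) (cong (j +_) (+-identityʳ j))) ⟩
  j + j ∸ j          ≡⟨ m+n∸n≡m j j ⟩
  j                  ∎
  where open ≡-Reasoning

target-even-free : ∀ i → ¬ AssignedBefore (suc i * 2) (suc i) → target (suc i * 2) ≡ suc i
target-even-free i free =
  trans (nextPos-free (j * 2) ts (even-rem j) not-in) (even-diff j)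
  where
  j = suc i
  ts = assignedUpTo (suc (i * 2))
  not-in : ¬ (j * 2 ∸ j * 2 / 2) ∈ ts
  not-in j∈ = free (∈assignedUpTo⇒ _ (subst (_∈ ts) (even-diff j) j∈))

target-even-taken : ∀ i → AssignedBefore (suc i * 2) (suc i) → target (suc i * 2) ≡ suc i * 3
target-even-taken i taken = begin
  target (j * 2)     ≡⟨ nextPos-taken (j * 2) ts (even-rem j) j∈ ⟩
  j * 2 + j * 2 / 2  ≡⟨ cong (j * 2 +_) (m*n/n≡m j 2) ⟩
  j * 2 + j          ≡⟨ sum j ⟩
  j * 3              ∎
  where
  open ≡-Reasoning
  j = suc i
  ts = assignedUpTo (suc (i * 2))
  j∈ : (j * 2 ∸ j * 2 / 2) ∈ ts
  j∈ = subst (_∈ ts) (sym (even-diff j)) (⇒∈assignedUpTo _ taken)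
  sum : ∀ j → j * 2 + j ≡ j * 3
  sum = solve-∀

data Parity : ℕ → Set where
  odd  : ∀ k → Parity (1 + k * 2)
  even : ∀ i → Parity (suc i * 2)

parity : ∀ n → Parity (suc n)
parity zero = odd 0
parity (suc n) with parity n
... | odd k  = even k
... | even i = odd (suc i)

data Residue : ℕ → Set where
  rem1 : ∀ q → Residue (1 + q * 3)
  rem2 : ∀ q → Residue (2 + q * 3)
  rem0 : ∀ q → Residue (suc q * 3)

residue : ∀ n → Residue (suc n)
residue zero = rem1 0
residue (suc n) with residue n
... | rem1 q = rem2 q
... | rem2 q = rem0 q
... | rem0 q = rem1 (suc q)

is-two? : (l : Letter) → Dec (l ≡ two)
is-two? two   = yes refl
is-two? three = no λ ()
is-two? four  = no λ ()

σ₃-two : ∀ {l} → σ₃ l ≡ two → l ≡ two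
σ₃-two {two} _ = refl

σ₃-other : ∀ {l} → l ≢ two → σ₃ l ≡ four
σ₃-other {two}   l≢2 = contradiction refl l≢2
σ₃-other {three} _   = refl
σ₃-other {four}  _   = refl

evenTarget : Letter → ℕ → ℕ
evenTarget two   j = j
evenTarget three j = j * 3
evenTarget four  j = j * 3

evenTarget-two : ∀ {l} j → l ≡ two → evenTarget l j ≡ j
evenTarget-two j refl = refl

evenTarget-other : ∀ {l} j → l ≢ two → evenTarget l j ≡ j * 3
evenTarget-other {two}   j l≢2 = contradiction refl l≢2
evenTarget-other {three} j _   = refl
evenTarget-other {four}  j _   = refl

module FixedPoint (s : ℕ → Letter) (fp : IsFixedPoint s) where

  s-rem1 : ∀ q → s (1 + q * 3) ≡ three
  s-rem1 q = subst (λ n → s n ≡ three) (shift q) (proj₁ (proj₂ fp q))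
    where
    shift : ∀ q → 3 * q + 1 ≡ 1 + q * 3
    shift = solve-∀

  s-rem2 : ∀ q → s (2 + q * 3) ≡ two
  s-rem2 q = subst (λ n → s n ≡ two) (shift q) (proj₁ (proj₂ (proj₂ fp q)))
    where
    shift : ∀ q → 3 * q + 2 ≡ 2 + q * 3
    shift = solve-∀

  s-rem0 : ∀ q → s (suc q * 3) ≡ σ₃ (s (suc q))
  s-rem0 q = subst (λ n → s n ≡ σ₃ (s (suc q))) (shift q) (proj₂ (proj₂ (proj₂ fp q)))
    where
    shift : ∀ q → 3 * q + 3 ≡ suc q * 3
    shift = solve-∀

  other-than-three⇒≥2 : ∀ {n} → 1 ≤ n → s n ≢ three → 2 ≤ n
  other-than-three⇒≥2 {suc zero}    _ s1≢3 = contradiction (proj₁ fp) s1≢3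
  other-than-three⇒≥2 {suc (suc _)} _ _    = s≤s (s≤s z≤n)

  StepRatio : ℕ → Set
  StepRatio m = Ratio (s (target m)) (target m) m

  ratio-from : ∀ {m n l} → target m ≡ n → s n ≡ l → Ratio l n m → StepRatio m
  ratio-from refl refl r = r

  ratio-at : ∀ {m n l} → target m ≡ n → s n ≡ l → StepRatio m → Ratio l n m
  ratio-at refl refl r = r

  ratio-odd : ∀ k → StepRatio (1 + k * 2)
  ratio-odd k = ratio-from (target-odd k) (s-rem1 k) (arith k)
    where
    arith : ∀ k → 3 * (1 + k * 2) ≡ 2 * (1 + k * 3) + 1
    arith = solve-∀

  EvenStep : ℕ → Set
  EvenStep i = target (suc i * 2) ≡ evenTarget (s (suc i)) (suc i)

  ratio-even : ∀ i → EvenStep i → StepRatio (suc i * 2)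
  ratio-even i step with is-two? (s (suc i))
  ... | yes sj≡2 = ratio-from (trans step (evenTarget-two _ sj≡2)) sj≡2 (*-comm (suc i) 2)
  ... | no sj≢2  = ratio-from (trans step (evenTarget-other _ sj≢2))
                     (trans (s-rem0 i) (σ₃-other sj≢2)) (arith (suc i))
    where
    arith : ∀ j → 3 * (j * 2) ≡ 2 * (j * 3)
    arith = solve-∀

  EarlierEvenSteps : ℕ → Set
  EarlierEvenSteps i = ∀ {i′} → i′ < i → EvenStep i′

  ratio-before : ∀ i → EarlierEvenSteps i → ∀ {m} → 1 ≤ m → m < suc i * 2 → StepRatio m
  ratio-before i earlier {suc n} _ m<2j with parity n
  ... | odd k   = ratio-odd k
  ... | even i′ = ratio-even i′ (earlier (s<s⁻¹ (*-cancelʳ-< 2 (suc i′) (suc i) m<2j)))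

  -- Hence position j = i + 1 is free at step 2j if s(j) = 2: a step m
  -- filling j with s(j) = 2 would be m = 2j.
  two⇒free : ∀ i → EarlierEvenSteps i → s (suc i) ≡ two → ¬ AssignedBefore (suc i * 2) (suc i)
  two⇒free i earlier sj≡2 (m , m≥1 , m<2j , fills-j) =
    <-irrefl (trans (ratio-at fills-j sj≡2 (ratio-before i earlier m≥1 m<2j)) (*-comm 2 (suc i))) m<2j

  -- ... and already taken otherwise: j = 1 + 3q is filled at step 1 + 2q,
  -- and j = 3j′ with s(j′) ≠ 2 at step 2j′.
  other⇒taken : ∀ i → EarlierEvenSteps i → s (suc i) ≢ two → AssignedBefore (suc i * 2) (suc i)
  other⇒taken i earlier sj≢2 with residue i
  ... | rem1 q = 1 + q * 2 , s≤s z≤n , ≤″⇒≤ (q * 4 , bound q) , target-odd q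
    where
    bound : ∀ q → suc (1 + q * 2) + q * 4 ≡ (1 + q * 3) * 2
    bound = solve-∀
  ... | rem2 q = contradiction (s-rem2 q) sj≢2
  ... | rem0 q = suc q * 2 , s≤s z≤n , ≤″⇒≤ (3 + q * 4 , bound q) , fills
    where
    bound : ∀ q → suc (suc q * 2) + (3 + q * 4) ≡ suc q * 3 * 2
    bound = solve-∀
    q<i : q < 2 + q * 3
    q<i = ≤″⇒≤ (1 + q * 2 , gap q)
      where
      gap : ∀ q → suc q + (1 + q * 2) ≡ 2 + q * 3
      gap = solve-∀
    s[q+1]≢2 : s (suc q) ≢ two
    s[q+1]≢2 t = sj≢2 (trans (s-rem0 q) (cong σ₃ t))
    fills : target (suc q * 2) ≡ suc q * 3
    fills = trans (earlier q<i) (evenTarget-other (suc q) s[q+1]≢2)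

  target-even : ∀ i → EvenStep i
  target-even = <-rec EvenStep step
    where
    step : ∀ i → EarlierEvenSteps i → EvenStep i
    step i earlier with is-two? (s (suc i))
    ... | yes sj≡2 = trans (target-even-free i (two⇒free i earlier sj≡2))
                           (sym (evenTarget-two (suc i) sj≡2))
    ... | no sj≢2  = trans (target-even-taken i (other⇒taken i earlier sj≢2))
                           (sym (evenTarget-other (suc i) sj≢2))

  even-two : ∀ i → s (suc i) ≡ two → target (suc i * 2) ≡ suc i
  even-two i t = trans (target-even i) (evenTarget-two (suc i) t)

  even-other : ∀ i → s (suc i) ≢ two → target (suc i * 2) ≡ suc i * 3
  even-other i o = trans (target-even i) (evenTarget-other (suc i) o)

  step-ratio : ∀ {m} → 1 ≤ m → StepRatio m
  step-ratio {m} m≥1 =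
    ratio-before m (λ {i′} _ → target-even i′) m≥1 (s≤s (m≤n⇒m≤1+n (m≤m*n m 2)))

  filled-once : ∀ {n a b} → IsPi n a → IsPi n b → a ≡ b
  filled-once {n} (a≥1 , ta) (b≥1 , tb) =
    ratio-injective (s n) (ratio-at ta refl (step-ratio a≥1)) (ratio-at tb refl (step-ratio b≥1))

  filled : ∀ {n} → 1 ≤ n → ∃ λ m → IsPi n m
  filled (s≤s {n = n} z≤n) with residue n
  ... | rem1 q = 1 + q * 2 , s≤s z≤n , target-odd q
  ... | rem2 q = (2 + q * 3) * 2 , s≤s z≤n , even-two (1 + q * 3) (s-rem2 q)
  ... | rem0 q with is-two? (s (suc q))
  ...   | yes t = suc q * 3 * 2 , s≤s z≤n , even-two (2 + q * 3) (trans (s-rem0 q) (cong σ₃ t))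
  ...   | no o  = suc q * 2 , s≤s z≤n , even-other q o

theorem5 : (s : ℕ → Letter) → IsFixedPoint s →
    (n : ℕ) → 1 ≤ n →
    ∃ λ m → IsPi n m × (∀ m′ → IsPi n m′ → m′ ≡ m)
    × (s n ≡ two ⇔ TypeII n m)
    × (s n ≡ three ⇔ TypeIII n m)
    × (s n ≡ four ⇔ TypeIV n m)
theorem5 s fp n n≥1 =
  let open FixedPoint s fp
      m , π = filled n≥1
      type : TypeOf (s n) n m
      type = ratio⇒type (s n) n≥1 (other-than-three⇒≥2 n≥1)
               (ratio-at (proj₂ π) refl (step-ratio (proj₁ π)))
  in m , π , (λ m′ π′ → filled-once π′ π) ,
     letter⇔type (s n) type two , letter⇔type (s n) type three , letter⇔type (s n) type four
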